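{- Let $\mathcal{W}=\{W_n:n<\omega\}$ be a partition of a subset of $\omega$ into infinite pairwise disjoint sets, and let $\mathcal{A}$ be a family of subsets of $\omega$ with the strong finite intersection property. For $i<\omega$ put $\widetilde{W}_i:=\bigcup_{n\ge i}W_n$ and $\widetilde{\mathcal{W}}:=\{\widetilde{W}_i:i<\omega\}$. Then the following are equivalent: (1) $\mathcal{A}$ is an external quasi-subbase of $\int\mathcal{W}$; (2) there exists a set $D\subseteq\omega$ such that $\mathcal{A}\cup\widetilde{\mathcal{W}}\cup\{D\}$ has the strong finite intersection property and $\int\mathcal{W}\subseteq\langle\mathcal{A}\cup\widetilde{\mathcal{W}}\cup\{D\}\rangle$.
   Context: A family of sets has the strong finite intersection property (sfip) if every finite subfamily has infinite intersection. If $\mathcal{A}$ has the sfip, $\langle\mathcal{A}\rangle$ denotes the filter generated by $\mathcal{A}$ (all subsets of $\omega$ containing a finite intersection of members of $\mathcal{A}$). For a partition $\mathcal{W}=\{W_n:n<\omega\}$ of a subset of $\omega$ into infinite sets, the contour $\int\mathcal{W}$ is the filter of all $W\subseteq\omega$ for which there is a cofinite $I\subseteq\omega$ such that $W\cap W_n$ is cofinite in $W_n$ for every $n\in I$. A family $\mathcal{A}$ is an external quasi-subbase (EQ-subbase) of a filter $\mathcal{F}$ if there is a countable family $\mathcal{B}$ such that $\mathcal{A}\cup\mathcal{B}$ has the sfip and $\mathcal{F}\subseteq\langle\mathcal{A}\cup\mathcal{B}\rangle$. -}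

module Defs where

open import Data.Nat using (ℕ; _≤_)
open import Data.Product using (Σ; ∃; ∃-syntax; _×_; _,_)
open import Data.Sum using (_⊎_)
open import Data.Empty using (⊥)
open import Data.Unit using (⊤)
open import Data.List using (List; []; _∷_)
open import Data.List.Relation.Unary.All using (All)
open import Relation.Nullary using (¬_)
open import Relation.Binary.PropositionalEquality using (_≢_)
open import Function.Bundles using (_⇔_)

Subset : Set₁
Subset = ℕ → Set

Family : Set₁
Family = Subset → Set

_⊆_ : Subset → Subset → Set
X ⊆ Y = ∀ k → X k → Y k

_≐_ : Subset → Subset → Set
X ≐ Y = ∀ k → X k ⇔ Y k

Infinite : Subset → Set
Infinite X = ∀ m → ∃[ n ] (m ≤ n × X n)

⋂ : List Subset → Subset
⋂ [] k = ⊤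
⋂ (X ∷ L) k = X k × ⋂ L k

SFIP : Family → Set₁
SFIP 𝒜 = (L : List Subset) → All 𝒜 L → Infinite (⋂ L)

⟨_⟩ : Family → Subset → Set₁
⟨ 𝒜 ⟩ Y = ∃[ L ] (All 𝒜 L × (⋂ L ⊆ Y))

_∪ᶠ_ : Family → Family → Family
(𝒜 ∪ᶠ ℬ) X = 𝒜 X ⊎ ℬ X

-- inclusion of families of subsets (target family may be large, e.g. ⟨𝒜⟩)
_⊑_ : (Subset → Set) → (Subset → Set₁) → Set₁
ℱ ⊑ 𝒢 = ∀ X → ℱ X → 𝒢 X

-- singleton family {D} (membership up to extensional equality)
｛_｝ : Subset → Family
｛ D ｝ X = X ≐ D

-- countable family: empty, or enumerated by a sequence
Countable : Family → Set₁
Countable ℬ = (∀ X → ¬ ℬ X)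
            ⊎ Σ (ℕ → Subset) (λ f → (∀ n → ℬ (f n)) × (∀ X → ℬ X → ∃[ n ] (f n ≐ X)))

IsPartition : (ℕ → Subset) → Set
IsPartition W = (∀ n → Infinite (W n))
              × (∀ n m k → n ≢ m → W n k → W m k → ⊥)

CofiniteIn : Subset → Subset → Set
CofiniteIn Wn Y = ∃[ m ] (∀ k → m ≤ k → Wn k → Y k)

-- the contour ∫W (a cofinite index set I contains all n ≥ i for some i)
∫ : (ℕ → Subset) → Subset → Set
∫ W Y = ∃[ i ] (∀ n → i ≤ n → CofiniteIn (W n) Y)

W̃ : (ℕ → Subset) → ℕ → Subset
W̃ W i k = ∃[ n ] (i ≤ n × W n k)

𝒲̃ : (ℕ → Subset) → Family
𝒲̃ W X = ∃[ i ] (X ≐ W̃ W i)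

EQSubbase : Family → (Subset → Set) → Set₁
EQSubbase 𝒜 ℱ = ∃[ ℬ ] (Countable ℬ × SFIP (𝒜 ∪ᶠ ℬ) × (ℱ ⊑ ⟨ 𝒜 ∪ᶠ ℬ ⟩))

-- A countable ℬ is enumerated by sets g 0, g 1, … of ⟨𝒜 ∪ ℬ⟩.  The sets
-- Basic i m = ⋃_{n ≥ i} (W_n ∖ [0, m n)) form a base of ∫𝒲, and each lies in
-- ⟨𝒜 ∪ ℬ⟩ via a generating list that mentions g n only for n ≤ ρ(i, m).  A
-- diagonal argument over the functions m shows that a single bound K works for
-- all of them up to intersecting with some W̃_j.  Hence D = g 0 ∩ … ∩ g K
-- together with 𝒜 and 𝒲̃ generates ∫𝒲; as D and every W̃_i lie in ⟨𝒜 ∪ ℬ⟩,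
-- the strong finite intersection property is inherited.  The converse takes
-- ℬ = 𝒲̃ ∪ {D}.
module Submission where

open import Defs
open import Data.Nat using (ℕ)
open import Data.Product using (∃-syntax; _×_)
open import Function.Bundles using (_⇔_)
open import Axiom.ExcludedMiddle using (ExcludedMiddle)
open import Level using (0ℓ)

open import Axiom.DoubleNegationElimination using (em⇒dne)
open import Data.Empty using (⊥-elim)
open import Data.List using ([]; _∷_; _++_)
open import Data.List.Relation.Unary.All using (All; []; _∷_)
open import Data.List.Relation.Unary.All.Properties using (++⁺)
open import Data.Nat using (zero; suc; _≤_; _⊔_; z≤n; s≤s; _≤?_; _≟_)
open import Data.Nat.Properties
  using (≤-refl; ≤-trans; m≤n⇒m<n∨m≡n; n≤0⇒n≡0; m⊔n≤o⇒m≤o; m⊔n≤o⇒n≤o; m≤m⊔n; m≤n⊔m)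
open import Data.Product using (_,_; proj₁; proj₂)
open import Data.Sum using (inj₁; inj₂; assocʳ; assocˡ)
open import Data.Unit using (tt)
open import Function.Bundles using (mk⇔; Equivalence)
import Function.Properties.Equivalence as ⇔
open import Relation.Nullary using (¬_; yes; no)
open import Relation.Binary.PropositionalEquality using (refl; sym; subst)

private
  variable
    𝒜 ℬ 𝒢 ℋ : Family
    X Y : Subset

_∩_ : Subset → Subset → Subset
(X ∩ Y) k = X k × Y k

⋂-++⁻ : ∀ L₁ L₂ → ⋂ (L₁ ++ L₂) ⊆ (⋂ L₁ ∩ ⋂ L₂)
⋂-++⁻ [] L₂ k r = tt , r
⋂-++⁻ (X ∷ L₁) L₂ k (x , r) =
  let (r₁ , r₂) = ⋂-++⁻ L₁ L₂ k r in (x , r₁) , r₂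

⟨⟩-member : 𝒢 X → ⟨ 𝒢 ⟩ X
⟨⟩-member {X = X} x = X ∷ [] , x ∷ [] , λ k → proj₁

⟨⟩-upward : X ⊆ Y → ⟨ ℋ ⟩ X → ⟨ ℋ ⟩ Y
⟨⟩-upward X⊆Y (L , p , s) = L , p , λ k r → X⊆Y k (s k r)

⟨⟩-∩ : ⟨ ℋ ⟩ X → ⟨ ℋ ⟩ Y → ⟨ ℋ ⟩ (X ∩ Y)
⟨⟩-∩ (L₁ , p₁ , s₁) (L₂ , p₂ , s₂) =
  L₁ ++ L₂ , ++⁺ p₁ p₂ , λ k r → let (r₁ , r₂) = ⋂-++⁻ L₁ L₂ k r in s₁ k r₁ , s₂ k r₂

⟨⟩-⋂ : 𝒢 ⊑ ⟨ ℋ ⟩ → ∀ {L} → All 𝒢 L → ⟨ ℋ ⟩ (⋂ L)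
⟨⟩-⋂ h []            = [] , [] , λ _ _ → tt
⟨⟩-⋂ h (_∷_ {X} x p) = ⟨⟩-∩ (h X x) (⟨⟩-⋂ h p)

⟨⟩-trans : 𝒢 ⊑ ⟨ ℋ ⟩ → ⟨ 𝒢 ⟩ Y → ⟨ ℋ ⟩ Y
⟨⟩-trans h (L , p , s) = ⟨⟩-upward s (⟨⟩-⋂ h p)

⊆ᶠ⇒⊑⟨⟩ : (∀ X → 𝒢 X → ℋ X) → 𝒢 ⊑ ⟨ ℋ ⟩
⊆ᶠ⇒⊑⟨⟩ h X x = ⟨⟩-member (h X x)

SFIP-⊑⟨⟩ : 𝒢 ⊑ ⟨ ℋ ⟩ → SFIP ℋ → SFIP 𝒢
SFIP-⊑⟨⟩ h sfip L p m =
  let (L′ , p′ , s) = ⟨⟩-⋂ h p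
      (n , m≤n , r) = sfip L′ p′ m
  in n , m≤n , s n r

≐⇒⊇ : X ≐ Y → Y ⊆ X
≐⇒⊇ e k = Equivalence.from (e k)

Enumerates : Family → (ℕ → Subset) → Set₁
Enumerates ℬ g = ∀ X → ℬ X → ∃[ n ] (g n ≐ X)

-- The empty family is "enumerated" by the constant ω, which lies in every ⟨𝒜 ∪ ℬ⟩.
countable⇒enumeration : Countable ℬ →
  ∃[ g ] ((∀ n → ⟨ 𝒜 ∪ᶠ ℬ ⟩ (g n)) × Enumerates ℬ g)
countable⇒enumeration (inj₁ empty) =
  (λ _ → ⋂ []) , (λ _ → [] , [] , λ _ _ → tt) , λ X x → ⊥-elim (empty X x)
countable⇒enumeration (inj₂ (g , g∈ℬ , enum)) =
  g , (λ n → ⟨⟩-member (inj₂ (g∈ℬ n))) , enum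

module _ (g : ℕ → Subset) where

  ⋂≤ : ℕ → Subset
  ⋂≤ K k = ∀ n → n ≤ K → g n k

  ⋂≤∈⟨⟩ : (∀ n → ⟨ ℋ ⟩ (g n)) → ∀ K → ⟨ ℋ ⟩ (⋂≤ K)
  ⋂≤∈⟨⟩ g∈ zero = ⟨⟩-upward (λ k x n n≤0 → subst (λ n → g n k) (sym (n≤0⇒n≡0 n≤0)) x) (g∈ 0)
  ⋂≤∈⟨⟩ g∈ (suc K) = ⟨⟩-upward split (⟨⟩-∩ (g∈ (suc K)) (⋂≤∈⟨⟩ g∈ K))
    where
    split : (g (suc K) ∩ ⋂≤ K) ⊆ ⋂≤ (suc K)
    split k (x , xs) n n≤1+K with m≤n⇒m<n∨m≡n n≤1+K
    ... | inj₁ (s≤s n≤K) = xs n n≤K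
    ... | inj₂ refl      = x

  EnumeratedBelow : ℕ → Family
  EnumeratedBelow K X = ∃[ n ] (n ≤ K × g n ≐ X)

  module _ (enum : Enumerates ℬ g) where

    index-bound : ∀ {L} → All (𝒜 ∪ᶠ ℬ) L → ℕ
    index-bound []                   = 0
    index-bound (inj₁ _ ∷ p)         = index-bound p
    index-bound (_∷_ {X} (inj₂ x) p) = proj₁ (enum X x) ⊔ index-bound p

    All-EnumeratedBelow : ∀ {L K} (p : All (𝒜 ∪ᶠ ℬ) L) → index-bound p ≤ K →
      All (𝒜 ∪ᶠ EnumeratedBelow K) L
    All-EnumeratedBelow []           _ = []
    All-EnumeratedBelow (inj₁ a ∷ p) b = inj₁ a ∷ All-EnumeratedBelow p b
    All-EnumeratedBelow (_∷_ {X} (inj₂ x) p) b =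
      let (n , gn≐X) = enum X x
      in inj₂ (n , m⊔n≤o⇒m≤o n _ b , gn≐X) ∷ All-EnumeratedBelow p (m⊔n≤o⇒n≤o n _ b)

  EnumeratedBelow-⊇⋂≤ : ∀ K → EnumeratedBelow K X → ⋂≤ K ⊆ X
  EnumeratedBelow-⊇⋂≤ K (n , n≤K , gn≐X) k x = Equivalence.to (gn≐X k) (x n n≤K)

max≤ : ℕ → (ℕ → ℕ) → ℕ
max≤ zero    h = h zero
max≤ (suc n) h = h (suc n) ⊔ max≤ n h

≤-max≤ : ∀ n h {k} → k ≤ n → h k ≤ max≤ n h
≤-max≤ zero    h z≤n = ≤-refl
≤-max≤ (suc n) h k≤1+n with m≤n⇒m<n∨m≡n k≤1+n
... | inj₁ (s≤s k≤n) = ≤-trans (≤-max≤ n h k≤n) (m≤n⊔m (h (suc n)) (max≤ n h))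
... | inj₂ refl      = m≤m⊔n (h (suc n)) (max≤ n h)

eventually-dominating : (f : ℕ → ℕ → ℕ) → ∃[ f* ] (∀ k n → k ≤ n → f k n ≤ f* n)
eventually-dominating f = (λ n → max≤ n (λ k → f k n)) , λ k n k≤n → ≤-max≤ n (λ k → f k n) k≤n

module _ (W : ℕ → Subset) where

  W̃∈∫ : ∀ i → ∫ W (W̃ W i)
  W̃∈∫ i = i , λ n i≤n → 0 , λ k _ w → n , i≤n , w

  Basic : ℕ → (ℕ → ℕ) → Subset
  Basic i m k = ∃[ n ] (i ≤ n × W n k × m n ≤ k)

  Basic∈∫ : ∀ i m → ∫ W (Basic i m)
  Basic∈∫ i m = i , λ n i≤n → m n , λ k m≤k w → n , i≤n , w , m≤k

  ∫⇒⊇Basic : ∫ W Y → ∃[ i ] ∃[ m ] (Basic i m ⊆ Y)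
  ∫⇒⊇Basic {Y} (i , cof) = i , m , Basic⊆Y
    where
    m : ℕ → ℕ
    m n with i ≤? n
    ... | yes i≤n = proj₁ (cof n i≤n)
    ... | no  _   = 0
    Basic⊆Y : Basic i m ⊆ Y
    Basic⊆Y k (n , i≤n , w , m≤k) with i ≤? n
    ... | yes i≤n′ = proj₂ (cof n i≤n′) k m≤k w
    ... | no  i≰n  = ⊥-elim (i≰n i≤n)

  _⊆ₜ_ : Subset → Subset → Set
  X ⊆ₜ Y = ∃[ j ] ((X ∩ W̃ W j) ⊆ Y)

  -- By disjointness, a point of Basic i′ m′ ∩ W̃_j lies in a single W_n, with
  -- n ≥ j ≥ K, where m n ≤ m′ n.
  Basic-⊆ₜ : IsPartition W → ∀ {i i′ m m′} K → (∀ n → K ≤ n → m n ≤ m′ n) →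
    Basic i′ m′ ⊆ₜ Basic i m
  Basic-⊆ₜ (_ , disjoint) {i} {i′} {m} {m′} K m≤m′ = K ⊔ i , sub
    where
    sub : (Basic i′ m′ ∩ W̃ W (K ⊔ i)) ⊆ Basic i m
    sub k ((n , _ , w , m′≤k) , (n′ , j≤n′ , w′)) with n ≟ n′
    ... | no  n≢n′ = ⊥-elim (disjoint n n′ k n≢n′ w w′)
    ... | yes refl =
      n , m⊔n≤o⇒n≤o K i j≤n′ , w , ≤-trans (m≤m′ n (m⊔n≤o⇒m≤o K i j≤n′)) m′≤k

  RefinableWithinRank : (ℕ → (ℕ → ℕ) → ℕ) → ℕ → ℕ → (ℕ → ℕ) → Set
  RefinableWithinRank ρ K i m = ∃[ i′ ] ∃[ m′ ] (ρ i′ m′ ≤ K × Basic i′ m′ ⊆ₜ Basic i m)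

  -- If every K fails, witnessed by Basic i_K m_K, then a function m* eventually
  -- dominating every m_K gives a set Basic 0 m* refuting its own rank K.
  rank-bound : ExcludedMiddle 0ℓ → IsPartition W → (ρ : ℕ → (ℕ → ℕ) → ℕ) →
    ∃[ K ] (∀ i m → RefinableWithinRank ρ K i m)
  rank-bound em partition ρ = dne λ noBound →
    let bad : ∀ K → ∃[ i ] ∃[ m ] ¬ RefinableWithinRank ρ K i m
        bad K = dne λ noBad → noBound (K , λ i m → dne λ nope → noBad (i , m , nope))
        (m* , dom) = eventually-dominating (λ K → proj₁ (proj₂ (bad K)))
        K = ρ 0 m*
    in proj₂ (proj₂ (bad K)) (0 , m* , ≤-refl , Basic-⊆ₜ partition K (dom K))
    where
    dne : ∀ {P : Set} → ¬ ¬ P → P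
    dne = em⇒dne em

module _ (W : ℕ → Subset) (𝒜 : Family) where

  WithTails : Subset → Family
  WithTails D = (𝒜 ∪ᶠ 𝒲̃ W) ∪ᶠ ｛ D ｝

  module _ (em : ExcludedMiddle 0ℓ) (partition : IsPartition W)
           (ℬ : Family) (sfip : SFIP (𝒜 ∪ᶠ ℬ)) (cover : ∫ W ⊑ ⟨ 𝒜 ∪ᶠ ℬ ⟩)
           (g : ℕ → Subset) (g∈ : ∀ n → ⟨ 𝒜 ∪ᶠ ℬ ⟩ (g n)) (enum : Enumerates ℬ g) where

    cover-Basic : ∀ i m → ⟨ 𝒜 ∪ᶠ ℬ ⟩ (Basic W i m)
    cover-Basic i m = cover (Basic W i m) (Basic∈∫ W i m)

    rank : ℕ → (ℕ → ℕ) → ℕ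
    rank i m = index-bound g enum (proj₁ (proj₂ (cover-Basic i m)))

    K : ℕ
    K = proj₁ (rank-bound W em partition rank)

    EnumeratedBelow⊑⟨WithTails⟩ : (𝒜 ∪ᶠ EnumeratedBelow g K) ⊑ ⟨ WithTails (⋂≤ g K) ⟩
    EnumeratedBelow⊑⟨WithTails⟩ X (inj₁ a) = ⟨⟩-member (inj₁ (inj₁ a))
    EnumeratedBelow⊑⟨WithTails⟩ X (inj₂ b) =
      ⟨⟩-upward (EnumeratedBelow-⊇⋂≤ g K b) (⟨⟩-member (inj₂ (λ _ → ⇔.refl)))

    ∫⊑⟨WithTails⋂≤⟩ : ∫ W ⊑ ⟨ WithTails (⋂≤ g K) ⟩
    ∫⊑⟨WithTails⋂≤⟩ Y Y∈∫ =
      let (i , m , Basic⊆Y) = ∫⇒⊇Basic W Y∈∫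
          (i′ , m′ , rank≤K , j , ∩W̃⊆Basic) = proj₂ (rank-bound W em partition rank) i m
          (L , p , ⋂L⊆Basic) = cover-Basic i′ m′
          ⋂L∈ = ⟨⟩-⋂ EnumeratedBelow⊑⟨WithTails⟩ (All-EnumeratedBelow g enum p rank≤K)
          W̃∈ = ⟨⟩-member (inj₁ (inj₂ (j , λ _ → ⇔.refl)))
      in ⟨⟩-upward (λ k (x , t) → Basic⊆Y k (∩W̃⊆Basic k (⋂L⊆Basic k x , t))) (⟨⟩-∩ ⋂L∈ W̃∈)

    WithTails⋂≤⊑⟨𝒜∪ℬ⟩ : WithTails (⋂≤ g K) ⊑ ⟨ 𝒜 ∪ᶠ ℬ ⟩
    WithTails⋂≤⊑⟨𝒜∪ℬ⟩ X (inj₁ (inj₁ a))       = ⟨⟩-member (inj₁ a)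
    WithTails⋂≤⊑⟨𝒜∪ℬ⟩ X (inj₁ (inj₂ (i , e))) = ⟨⟩-upward (≐⇒⊇ e) (cover (W̃ W i) (W̃∈∫ W i))
    WithTails⋂≤⊑⟨𝒜∪ℬ⟩ X (inj₂ e)              = ⟨⟩-upward (≐⇒⊇ e) (⋂≤∈⟨⟩ g g∈ K)

    enumerated-EQSubbase⇒WithTails :
      ∃[ D ] (SFIP (WithTails D) × (∫ W ⊑ ⟨ WithTails D ⟩))
    enumerated-EQSubbase⇒WithTails =
      ⋂≤ g K , SFIP-⊑⟨⟩ WithTails⋂≤⊑⟨𝒜∪ℬ⟩ sfip , ∫⊑⟨WithTails⋂≤⟩

  EQSubbase⇒WithTails : ExcludedMiddle 0ℓ → IsPartition W → EQSubbase 𝒜 (∫ W) →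
    ∃[ D ] (SFIP (WithTails D) × (∫ W ⊑ ⟨ WithTails D ⟩))
  EQSubbase⇒WithTails em partition (ℬ , countable , sfip , cover) =
    let (g , g∈ , enum) = countable⇒enumeration countable
    in enumerated-EQSubbase⇒WithTails em partition ℬ sfip cover g g∈ enum

  countable-𝒲̃∪｛｝ : ∀ D → Countable (𝒲̃ W ∪ᶠ ｛ D ｝)
  countable-𝒲̃∪｛｝ D = inj₂ (f , f∈ , enum)
    where
    f : ℕ → Subset
    f zero    = D
    f (suc i) = W̃ W i
    f∈ : ∀ n → (𝒲̃ W ∪ᶠ ｛ D ｝) (f n)
    f∈ zero    = inj₂ (λ _ → ⇔.refl)
    f∈ (suc i) = inj₁ (i , λ _ → ⇔.refl)
    enum : Enumerates (𝒲̃ W ∪ᶠ ｛ D ｝) f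
    enum X (inj₁ (i , e)) = suc i , λ k → ⇔.sym (e k)
    enum X (inj₂ e)       = zero , λ k → ⇔.sym (e k)

  WithTails⇒EQSubbase : ∃[ D ] (SFIP (WithTails D) × (∫ W ⊑ ⟨ WithTails D ⟩)) →
    EQSubbase 𝒜 (∫ W)
  WithTails⇒EQSubbase (D , sfip , cover) =
    𝒲̃ W ∪ᶠ ｛ D ｝ , countable-𝒲̃∪｛｝ D ,
    SFIP-⊑⟨⟩ (⊆ᶠ⇒⊑⟨⟩ λ _ → assocˡ) sfip ,
    λ Y Y∈∫ → ⟨⟩-trans (⊆ᶠ⇒⊑⟨⟩ λ _ → assocʳ) (cover Y Y∈∫)

proposition3 : ExcludedMiddle 0ℓ → (W : ℕ → Subset) → IsPartition W → (𝒜 : Family) → SFIP 𝒜 →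
    EQSubbase 𝒜 (∫ W)
      ⇔ (∃[ D ] (SFIP ((𝒜 ∪ᶠ 𝒲̃ W) ∪ᶠ ｛ D ｝) × (∫ W ⊑ ⟨ (𝒜 ∪ᶠ 𝒲̃ W) ∪ᶠ ｛ D ｝ ⟩)))
proposition3 em W partition 𝒜 _ =
  mk⇔ (EQSubbase⇒WithTails W 𝒜 em partition) (WithTails⇒EQSubbase W 𝒜)
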